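{- There exist graphs $G$ of order $n$ with $\mathrm{bdim}(G)=O(\log n)$; that is, there is an absolute constant $C>0$ such that for every integer $n\ge 2$ there is a graph $G$ on $n$ vertices with $\mathrm{bdim}(G)\le C\log n$.
   Context: All graphs are finite, simple and undirected. For vertices $x,y$ of a graph $G$, $d(x,y)$ is the length of a shortest $x$–$y$ path in $G$ ($\infty$ if $x,y$ lie in different components). For a positive integer $k$, let $d_k(x,y)=\min\{d(x,y),k+1\}$. A function $f:V(G)\to\mathbb{Z}_{\ge 0}$ is a resolving broadcast of $G$ if for any two distinct $x,y\in V(G)$ there is a vertex $z$ with $f(z)=i>0$ and $d_i(x,z)\neq d_i(y,z)$. The broadcast dimension $\mathrm{bdim}(G)$ is the minimum of $\sum_{v\in V(G)} f(v)$ over all resolving broadcasts $f$ of $G$. -}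

module Defs where

open import Data.Nat using (ℕ; zero; suc; _<_; _≤_)
open import Data.Fin using (Fin; _≟_)
open import Data.Bool using (Bool; true; false; _∨_; _∧_; if_then_else_)
open import Data.List using (List; allFin; map)
open import Data.Bool.ListAction using (any)
open import Data.Nat.ListAction using (sum)
open import Data.Product using (Σ; _×_)
open import Relation.Nullary.Decidable using (⌊_⌋)
open import Relation.Binary.PropositionalEquality using (_≡_; _≢_)

record Graph (n : ℕ) : Set where
  field
    adj       : Fin n → Fin n → Bool
    adj-sym   : ∀ x y → adj x y ≡ adj y x
    adj-irrefl : ∀ x → adj x x ≡ false
open Graph public

-- reach G m x y = true  iff  there is an x–y walk of length ≤ m in G,
-- i.e. iff d(x,y) ≤ m.
reach : ∀ {n} → Graph n → ℕ → Fin n → Fin n → Bool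
reach G zero    x y = ⌊ x ≟ y ⌋
reach {n} G (suc m) x y =
  reach G m x y ∨ any (λ z → reach G m x z ∧ adj G z y) (allFin n)

-- Truncated distance d_k(x,y) = min{ d(x,y) , k+1 }:
-- the least j ∈ {0,…,k} with d(x,y) ≤ j, and k+1 if there is none
-- (this includes d(x,y) = ∞).
dtrunc : ∀ {n} → Graph n → ℕ → Fin n → Fin n → ℕ
dtrunc G k x y = go 0 (suc k)
  where
  go : ℕ → ℕ → ℕ
  go j zero    = j
  go j (suc r) = if reach G j x y then j else go (suc j) r

cost : ∀ {n} → (Fin n → ℕ) → ℕ
cost {n} f = sum (map f (allFin n))

IsResolvingBroadcast : ∀ {n} → Graph n → (Fin n → ℕ) → Set
IsResolvingBroadcast {n} G f =
  (x y : Fin n) → x ≢ y →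
  Σ (Fin n) λ z → (0 < f z) × (dtrunc G (f z) x z ≢ dtrunc G (f z) y z)

BdimAtMost : ∀ {n} → Graph n → ℕ → Set
BdimAtMost {n} G k = Σ (Fin n → ℕ) λ f → IsResolvingBroadcast G f × (cost f ≤ k)

-- Put k = ⌊log₂ n⌋ + 1, so that n ≤ 2^k.  The vertices 0,…,k-1 of the
-- graph on {0,…,n-1} are "landmarks", one for each binary digit; a
-- landmark i is joined to a non-landmark v exactly when digit i of v is 1.
-- Broadcasting with strength 1 from every landmark costs k ≤ 2⌊log₂ n⌋.
-- With strength 1 a landmark z sees a vertex x at truncated distance 0 if
-- x = z and otherwise at 1 or 2 according to whether x is adjacent to z.
-- Hence a landmark is resolved from every other vertex by itself, and two
-- distinct non-landmarks are resolved by a landmark at a binary digit in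
-- which they differ (such a digit exists below k since both are < 2^k).
module Submission where

open import Defs
open import Data.Nat using (ℕ; _<_; _≤_; _*_)
open import Data.Nat.Logarithm using (⌊log₂_⌋)
open import Data.Product using (Σ; _×_)

open import Data.Nat using (zero; suc; _+_; _^_; _<ᵇ_; _≡ᵇ_; z≤n; s≤s; z<s; s<s; NonZero)
open import Data.Nat.Properties
  using (≤-trans; <-≤-trans; ≤-<-trans; <⇒≤; ≮⇒≥; n<1⇒n≡0; *-comm;
         +-monoˡ-≤; +-identityʳ; 1+n≰n; <⇒<ᵇ)
open import Data.Nat.DivMod using (_/_; _%_; m≡m%n+[m/n]*n; m%n<n; m<n*o⇒m/o<n)
open import Data.Nat.Logarithm using (⌊log₂⌋-mono-≤; ⌊log₂[2^n]⌋≡n)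
open import Data.Nat.ListAction using (sum)
open import Data.Fin using (Fin; toℕ; fromℕ<; _≟_)
open import Data.Fin.Properties using (toℕ-injective; toℕ-fromℕ<; toℕ<n)
open import Data.Bool using (Bool; true; false; _∨_; _∧_; not; if_then_else_; T)
open import Data.Bool.Properties using (∨-comm; T-≡; T-∧; ⇔→≡)
open import Data.Bool.ListAction using (any)
open import Data.List using (allFin; tabulate)
open import Data.List.Properties using (map-tabulate)
open import Data.List.Relation.Unary.Any using (satisfied)
import Data.List.Relation.Unary.Any as Any
open import Data.List.Relation.Unary.Any.Properties using (any⁺; any⁻)
open import Data.List.Membership.Propositional.Properties using (∈-allFin)
open import Data.Product using (_,_; proj₂)
open import Data.Empty using (⊥-elim)
open import Function using (id; _∘_)
open import Function.Bundles using (mk⇔; Equivalence)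
open import Relation.Nullary using (yes; no)
open import Relation.Nullary.Decidable using (⌊_⌋)
open import Relation.Binary.PropositionalEquality
  using (_≡_; _≢_; refl; sym; trans; cong; cong₂; subst; module ≡-Reasoning)

open Equivalence using (to; from)

digit : (b : ℕ) .{{_ : NonZero b}} → ℕ → ℕ → ℕ
digit b zero    a = a % b
digit b (suc i) a = digit b i (a / b)

digit<base : ∀ (b : ℕ) .{{_ : NonZero b}} i a → digit b i a < b
digit<base b zero    a = m%n<n a b
digit<base b (suc i) a = digit<base b i (a / b)

quotient< : ∀ (b : ℕ) .{{_ : NonZero b}} k {m} → m < b ^ suc k → m / b < b ^ k
quotient< b k {m} m< = m<n*o⇒m/o<n (subst (m <_) (*-comm b (b ^ k)) m<)

divMod-injective : ∀ (b : ℕ) .{{_ : NonZero b}} {a c} →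
                   a % b ≡ c % b → a / b ≡ c / b → a ≡ c
divMod-injective b {a} {c} r≡ q≡ = begin
  a                 ≡⟨ m≡m%n+[m/n]*n a b ⟩
  a % b + a / b * b ≡⟨ cong₂ (λ r q → r + q * b) r≡ q≡ ⟩
  c % b + c / b * b ≡⟨ sym (m≡m%n+[m/n]*n c b) ⟩
  c                 ∎
  where open ≡-Reasoning

digits-separate : ∀ (b : ℕ) .{{_ : NonZero b}} k {a c} →
                  a < b ^ k → c < b ^ k → a ≢ c →
                  Σ ℕ λ i → i < k × digit b i a ≢ digit b i c
digits-separate b zero a<1 c<1 a≢c =
  ⊥-elim (a≢c (trans (n<1⇒n≡0 a<1) (sym (n<1⇒n≡0 c<1))))
digits-separate b (suc k) {a} {c} a< c< a≢c with a % b Data.Nat.≟ c % b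
... | no lastDigit≢ = 0 , z<s , lastDigit≢
... | yes lastDigit≡
  with i , i<k , differ ← digits-separate b k (quotient< b k a<) (quotient< b k c<)
                                          (a≢c ∘ divMod-injective b lastDigit≡)
     = suc i , s<s i<k , differ

≡ᵇ1-injective : ∀ {d e} → d < 2 → e < 2 → d ≢ e → (d ≡ᵇ 1) ≢ (e ≡ᵇ 1)
≡ᵇ1-injective {0} {0} _ _ d≢e _ = d≢e refl
≡ᵇ1-injective {1} {1} _ _ d≢e _ = d≢e refl
≡ᵇ1-injective {0} {1} _ _ _ ()
≡ᵇ1-injective {1} {0} _ _ _ ()
≡ᵇ1-injective {suc (suc _)} (s≤s (s≤s ()))
≡ᵇ1-injective {_} {suc (suc _)} _ (s≤s (s≤s ()))

bit : ℕ → ℕ → Bool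
bit i a = digit 2 i a ≡ᵇ 1

bits-separate : ∀ k {a c} → a < 2 ^ k → c < 2 ^ k → a ≢ c →
                Σ ℕ λ i → i < k × bit i a ≢ bit i c
bits-separate k a< c< a≢c
  with i , i<k , differ ← digits-separate 2 k a< c< a≢c
     = i , i<k , ≡ᵇ1-injective (digit<base 2 i _) (digit<base 2 i _) differ

module _ {n : ℕ} (G : Graph n) where

  oneStep-reach : ∀ x z → any (λ w → ⌊ x ≟ w ⌋ ∧ adj G w z) (allFin n) ≡ adj G x z
  oneStep-reach x z = ⇔→≡ (mk⇔ (to T-≡ ∘ fromWitness ∘ satisfied ∘ any⁻ viaW (allFin n) ∘ from T-≡)
                                (to T-≡ ∘ any⁺ viaW ∘ atX ∘ from T-≡))
    where
    viaW : Fin n → Bool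
    viaW w = ⌊ x ≟ w ⌋ ∧ adj G w z

    fromWitness : Σ (Fin n) (T ∘ viaW) → T (adj G x z)
    fromWitness (w , t) with x ≟ w
    ... | yes refl = proj₂ (to T-∧ t)

    atSelf : T (adj G x z) → T (⌊ x ≟ x ⌋ ∧ adj G x z)
    atSelf t with x ≟ x
    ... | yes _   = t
    ... | no x≢x = ⊥-elim (x≢x refl)

    atX : T (adj G x z) → Any.Any (T ∘ viaW) (allFin n)
    atX t = Any.map (λ { refl → atSelf t }) (∈-allFin x)

  dtrunc-self : ∀ x → dtrunc G 1 x x ≡ 0
  dtrunc-self x with x ≟ x
  ... | yes _   = refl
  ... | no x≢x = ⊥-elim (x≢x refl)

  dtrunc-other : ∀ x z → x ≢ z → dtrunc G 1 x z ≡ (if adj G x z then 1 else 2)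
  dtrunc-other x z x≢z with x ≟ z
  ... | yes x≡z = ⊥-elim (x≢z x≡z)
  ... | no _ rewrite oneStep-reach x z = refl

  centre-resolves : ∀ y z → y ≢ z → dtrunc G 1 z z ≢ dtrunc G 1 y z
  centre-resolves y z y≢z eq with adj G y z | trans (sym (dtrunc-self z)) (trans eq (dtrunc-other y z y≢z))
  ... | true  | ()
  ... | false | ()

  neighbour-resolves : ∀ x y z → x ≢ z → y ≢ z → adj G x z ≢ adj G y z →
                       dtrunc G 1 x z ≢ dtrunc G 1 y z
  neighbour-resolves x y z x≢z y≢z adj≢ eq
    with adj G x z | adj G y z | trans (sym (dtrunc-other x z x≢z)) (trans eq (dtrunc-other y z y≢z))
  ... | true  | true  | _  = adj≢ refl
  ... | false | false | _  = adj≢ refl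
  ... | true  | false | ()
  ... | false | true  | ()

indicator : ∀ {n} → (Fin n → Bool) → Fin n → ℕ
indicator L z = if L z then 1 else 0

resolvedAt : ∀ {n} (G : Graph n) (L : Fin n → Bool) {u v} z → L z ≡ true →
             dtrunc G 1 u z ≢ dtrunc G 1 v z →
             (0 < indicator L z) × (dtrunc G (indicator L z) u z ≢ dtrunc G (indicator L z) v z)
resolvedAt G L z Lz d rewrite Lz = z<s , d

landmarks-resolve :
  ∀ {n} (G : Graph n) (L : Fin n → Bool) →
  (∀ x y → x ≢ y → L x ≡ false → L y ≡ false →
     Σ (Fin n) λ z → L z ≡ true × adj G x z ≢ adj G y z) →
  IsResolvingBroadcast G (indicator L)
landmarks-resolve G L separated x y x≢y with L x in Lx | L y in Ly
... | true  | _     = x , resolvedAt G L x Lx (centre-resolves G y x (x≢y ∘ sym))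
... | false | true  = y , resolvedAt G L y Ly (centre-resolves G x y x≢y ∘ sym)
... | false | false
  with z , Lz , adj≢ ← separated x y x≢y Lx Ly
     = z , resolvedAt G L z Lz (neighbour-resolves G x y z (notLandmark Lx) (notLandmark Ly) adj≢)
  where
  notLandmark : ∀ {v} → L v ≡ false → v ≢ z
  notLandmark Lv refl with () ← trans (sym Lv) Lz

landmark : ∀ {n} → ℕ → Fin n → Bool
landmark k z = toℕ z <ᵇ k

cost-landmark : ∀ n k → cost (indicator (landmark {n} k)) ≤ k
cost-landmark n k =
  subst (_≤ k) (sym (cong sum (map-tabulate id (indicator (landmark {n} k))))) (sum≤ n k)
  where
  sum≤ : ∀ n k → sum (tabulate (indicator (landmark {n} k))) ≤ k
  sum≤ zero    k       = z≤n
  sum≤ (suc n) zero    = sum≤ n zero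
  sum≤ (suc n) (suc k) = s≤s (sum≤ n k)

symmetrise : ∀ n (R : ℕ → ℕ → Bool) → (∀ a → R a a ≡ false) → Graph n
symmetrise n R R-irrefl = record
  { adj        = λ x y → R (toℕ x) (toℕ y) ∨ R (toℕ y) (toℕ x)
  ; adj-sym    = λ x y → ∨-comm (R (toℕ x) (toℕ y)) (R (toℕ y) (toℕ x))
  ; adj-irrefl = λ x → cong (λ r → r ∨ r) (R-irrefl (toℕ x))
  }

bitEdge : ℕ → ℕ → ℕ → Bool
bitEdge k a v = (a <ᵇ k) ∧ not (v <ᵇ k) ∧ bit a v

-- No vertex is both a landmark and a non-landmark, so bitEdge has no loops.
bitEdge-irrefl : ∀ k a → bitEdge k a a ≡ false
bitEdge-irrefl k a with a <ᵇ k
... | true  = refl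
... | false = refl

binaryGraph : ∀ n k → Graph n
binaryGraph n k = symmetrise n (bitEdge k) (bitEdge-irrefl k)

binaryGraph-adj : ∀ {n} k (v z : Fin n) → landmark k v ≡ false → landmark k z ≡ true →
                  adj (binaryGraph n k) v z ≡ bit (toℕ z) (toℕ v)
binaryGraph-adj k v z v≥k z<k rewrite v≥k | z<k = refl

binaryGraph-separates :
  ∀ {n} k → n ≤ 2 ^ k → ∀ (x y : Fin n) → x ≢ y →
  landmark k x ≡ false → landmark k y ≡ false →
  Σ (Fin n) λ z → landmark k z ≡ true × adj (binaryGraph n k) x z ≢ adj (binaryGraph n k) y z
binaryGraph-separates {n} k n≤2ᵏ x y x≢y x≥k y≥k =
  landmarkAt (bits-separate k (below x) (below y) (x≢y ∘ toℕ-injective))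
  where
  G = binaryGraph n k

  below : ∀ (v : Fin n) → toℕ v < 2 ^ k
  below v = <-≤-trans (toℕ<n v) n≤2ᵏ

  -- the index of a differing bit is a vertex, since i < k ≤ x < n
  landmarkAt : Σ ℕ (λ i → i < k × bit i (toℕ x) ≢ bit i (toℕ y)) →
               Σ (Fin n) λ z → landmark k z ≡ true × adj G x z ≢ adj G y z
  landmarkAt (i , i<k , bit≢) = z , z<k , adj≢
    where
    i<n : i < n
    i<n = <-≤-trans i<k (<⇒≤ (≤-<-trans (≮⇒≥ (λ x<k → subst T x≥k (<⇒<ᵇ x<k))) (toℕ<n x)))

    z : Fin n
    z = fromℕ< i<n

    z<k : landmark k z ≡ true
    z<k = to T-≡ (subst (λ j → T (j <ᵇ k)) (sym (toℕ-fromℕ< i<n)) (<⇒<ᵇ i<k))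

    adj≢ : adj G x z ≢ adj G y z
    adj≢ eq = bit≢ (begin
      bit i (toℕ x)       ≡⟨ cong (λ j → bit j (toℕ x)) (sym (toℕ-fromℕ< i<n)) ⟩
      bit (toℕ z) (toℕ x) ≡⟨ sym (binaryGraph-adj k x z x≥k z<k) ⟩
      adj G x z           ≡⟨ eq ⟩
      adj G y z           ≡⟨ binaryGraph-adj k y z y≥k z<k ⟩
      bit (toℕ z) (toℕ y) ≡⟨ cong (λ j → bit j (toℕ y)) (toℕ-fromℕ< i<n) ⟩
      bit i (toℕ y)       ∎)
      where open ≡-Reasoning

binaryGraph-bdim : ∀ n k → n ≤ 2 ^ k → BdimAtMost (binaryGraph n k) k
binaryGraph-bdim n k n≤2ᵏ =
  indicator (landmark k) ,
  landmarks-resolve (binaryGraph n k) (landmark k) (binaryGraph-separates k n≤2ᵏ) ,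
  cost-landmark n k

n<2^[1+log₂n] : ∀ n → n < 2 ^ suc ⌊log₂ n ⌋
n<2^[1+log₂n] n with n Data.Nat.<? 2 ^ suc ⌊log₂ n ⌋
... | yes n< = n<
... | no n≮ = ⊥-elim (1+n≰n (subst (_≤ ⌊log₂ n ⌋) (⌊log₂[2^n]⌋≡n (suc ⌊log₂ n ⌋))
                                     (⌊log₂⌋-mono-≤ (≮⇒≥ n≮))))

-- For n ≥ 2 the bound ⌊log₂ n⌋ + 1 ≤ 2⌊log₂ n⌋ is available.
1≤log₂n : ∀ {n} → 2 ≤ n → 1 ≤ ⌊log₂ n ⌋
1≤log₂n {n} 2≤n = subst (_≤ ⌊log₂ n ⌋) (⌊log₂[2^n]⌋≡n 1) (⌊log₂⌋-mono-≤ 2≤n)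

theorem3p7 : Σ ℕ λ C → (0 < C) ×
    ((n : ℕ) → 2 ≤ n → Σ (Graph n) λ G → BdimAtMost G (C * ⌊log₂ n ⌋))
theorem3p7 = 2 , z<s , λ n 2≤n →
  let ℓ = ⌊log₂ n ⌋
      f , resolving , cost≤1+ℓ = binaryGraph-bdim n (suc ℓ) (<⇒≤ (n<2^[1+log₂n] n))
      1+ℓ≤2ℓ : suc ℓ ≤ 2 * ℓ
      1+ℓ≤2ℓ = subst (suc ℓ ≤_) (cong (ℓ +_) (sym (+-identityʳ ℓ))) (+-monoˡ-≤ ℓ (1≤log₂n 2≤n))
  in binaryGraph n (suc ℓ) , f , resolving , ≤-trans cost≤1+ℓ 1+ℓ≤2ℓ
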